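{- For every integer $n\ge 3$, $\mu_{\rm t}(L(K_n))\ge n-1+\left\lfloor\frac{n-1}{2}\right\rfloor$.
   Context: $L(K_n)$ is the line graph of the complete graph $K_n$. For a connected graph $H$ and $X\subseteq V(H)$, two vertices are $X$-visible if there is a shortest path between them whose internal vertices are not in $X$; $X$ is a total mutual-visibility set if every two vertices of $H$ are $X$-visible, and $\mu_{\rm t}(H)$ is the maximum cardinality of such a set. -}

module Defs where

open import Level using (0ℓ)
open import Data.Nat using (ℕ; zero; suc; _≤_)
open import Data.Fin using (Fin) renaming (_<_ to _<ᶠ_)
open import Data.Product using (Σ; _×_; _,_; proj₁)
open import Data.Sum using (_⊎_)
open import Data.List using (List; []; _∷_; length)
open import Data.List.Membership.Propositional using (_∈_)
open import Data.List.Relation.Unary.Unique.Propositional using (Unique)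
open import Relation.Binary.PropositionalEquality using (_≡_)
open import Relation.Nullary using (¬_)

module _ {V : Set} (Adj : V → V → Set) where

  data Walk : V → V → Set where
    nil  : ∀ {u} → Walk u u
    cons : ∀ {u w v} → Adj u w → Walk w v → Walk u v

  len : ∀ {u v} → Walk u v → ℕ
  len nil        = zero
  len (cons _ p) = suc (len p)

  starts : ∀ {u v} → Walk u v → List V
  starts nil            = []
  starts (cons {u} _ p) = u ∷ starts p

  internal : ∀ {u v} → Walk u v → List V
  internal nil        = []
  internal (cons _ p) = starts p

  -- a shortest u,v-walk (necessarily a shortest path)
  IsShortest : ∀ {u v} → Walk u v → Set
  IsShortest {u} {v} p = ∀ (q : Walk u v) → len p ≤ len q

  Visible : List V → V → V → Set
  Visible X u v = Σ (Walk u v) λ p → IsShortest p × (∀ x → x ∈ internal p → ¬ (x ∈ X))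

  IsTotalMutualVisibility : List V → Set
  IsTotalMutualVisibility X = ∀ u v → Visible X u v

  -- μ_t(H) ≥ k : there is a total mutual-visibility set of cardinality ≥ k
  -- (a set is represented as a duplicate-free list)
  μt≥ : ℕ → Set
  μt≥ k = Σ (List V) λ X → Unique X × k ≤ length X × IsTotalMutualVisibility X

-- The line graph L(K_n) of the complete graph K_n.
-- Vertices: edges {i,j} of K_n, represented as pairs (i , j) with i < j.

LKV : ℕ → Set
LKV n = Σ (Fin n × Fin n) λ { (i , j) → i <ᶠ j }

LKAdj : (n : ℕ) → LKV n → LKV n → Set
LKAdj n ((a , b) , _) ((c , d) , _) =
  ¬ ((a , b) ≡ (c , d)) × (a ≡ c ⊎ a ≡ d ⊎ b ≡ c ⊎ b ≡ d)

module Submission where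

-- Two disjoint edges {a , b} and {c , d} of K_n are at distance 2 in L(K_n), and the middle
-- vertex of a shortest path between them is one of the cross edges {a , c}, {a , d}, {b , c},
-- {b , d}. All four lie in X only if X contains the four-cycle a c b d, so the edge set of any
-- C₄-free subgraph of K_n is a total mutual-visibility set. The windmill (a star at one vertex
-- together with a maximum matching of the other n - 1) is C₄-free, because a vertex off the
-- hub has at most one neighbour besides the hub; it has n - 1 + ⌊(n - 1)/2⌋ edges.

open import Defs
open import Data.Nat using (ℕ; zero; suc; _≤_; _+_; _∸_; _/_; _<_; ⌊_/2⌋; z≤n; s≤s)
open import Data.Nat.Properties using (suc-injective; ≤-irrelevant; ≤-reflexive; <-irrefl)
  renaming (_≟_ to _≟ℕ_)
open import Data.Nat.DivMod using (m/n≡1+[m∸n]/n)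
open import Data.Fin using (Fin; toℕ) renaming (zero to fzero; suc to fsuc)
open import Data.Fin.Properties using (<-cmp; toℕ-injective) renaming (_≟_ to _≟ᶠ_)
open import Data.Product using (Σ-syntax; _×_; _,_; proj₁; proj₂)
open import Data.Product.Properties using (≡-dec)
open import Data.Sum using (_⊎_; inj₁; inj₂)
open import Data.Empty using (⊥; ⊥-elim)
open import Data.List using (List; []; _∷_; length; map; _++_; allFin)
open import Data.List.Properties using (length-++; length-map; length-tabulate)
open import Data.List.Membership.Propositional using (_∈_; _∉_)
open import Data.List.Membership.Propositional.Properties using (∈-map⁻; ∈-++⁻)
import Data.List.Relation.Unary.All as All
open import Data.List.Relation.Unary.AllPairs using ([]; _∷_)
open import Data.List.Relation.Unary.Any using (here; there)
open import Data.List.Relation.Unary.Unique.Propositional using (Unique)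
import Data.List.Relation.Unary.Unique.Propositional.Properties as Unique
open import Function using (_∘_; _on_; Injective)
open import Level using (Level)
open import Relation.Binary using (Rel; Decidable; Symmetric; tri<; tri≈; tri>)
import Relation.Binary.Construct.On as On
open import Relation.Binary.PropositionalEquality
open import Relation.Nullary using (¬_; Dec; yes; no)
open import Relation.Nullary.Decidable using (_⊎-dec_)

private
  variable
    a ℓ : Level
    A B : Set a

partner : ℕ → ℕ
partner zero          = 1
partner (suc zero)    = 0
partner (suc (suc x)) = suc (suc (partner x))

⌊/2⌋-partner : ∀ x y → ⌊ x /2⌋ ≡ ⌊ y /2⌋ → x ≢ y → y ≡ partner x
⌊/2⌋-partner zero          zero          _  x≢y = ⊥-elim (x≢y refl)
⌊/2⌋-partner zero          (suc zero)    _  _   = refl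
⌊/2⌋-partner (suc zero)    zero          _  _   = refl
⌊/2⌋-partner (suc zero)    (suc zero)    _  x≢y = ⊥-elim (x≢y refl)
⌊/2⌋-partner (suc (suc x)) (suc (suc y)) eq x≢y =
  cong (suc ∘ suc) (⌊/2⌋-partner x y (suc-injective eq) (x≢y ∘ cong (suc ∘ suc)))

⌊/2⌋-fibre-≤2 : ∀ {x y z} → ⌊ x /2⌋ ≡ ⌊ y /2⌋ → ⌊ x /2⌋ ≡ ⌊ z /2⌋ →
                x ≢ y → x ≢ z → y ≡ z
⌊/2⌋-fibre-≤2 {x} {y} {z} xy xz x≢y x≢z =
  trans (⌊/2⌋-partner x y xy x≢y) (sym (⌊/2⌋-partner x z xz x≢z))

n/2≡⌊n/2⌋ : ∀ n → n / 2 ≡ ⌊ n /2⌋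
n/2≡⌊n/2⌋ zero          = refl
n/2≡⌊n/2⌋ (suc zero)    = refl
n/2≡⌊n/2⌋ (suc (suc n)) =
  trans (m/n≡1+[m∸n]/n {suc (suc n)} {2} (s≤s (s≤s z≤n))) (cong suc (n/2≡⌊n/2⌋ n))

C4Free : Rel A ℓ → Set _
C4Free F = ∀ {a b c d} → a ≢ b → a ≢ c → a ≢ d → b ≢ c → b ≢ d → c ≢ d →
           F a c → F a d → F b c → F b d → ⊥

C4Free-on : {F : Rel A ℓ} (f : B → A) → Injective _≡_ _≡_ f → C4Free F → C4Free (F on f)
C4Free-on f f-inj c4 a≢b a≢c a≢d b≢c b≢d c≢d =
  c4 (a≢b ∘ f-inj) (a≢c ∘ f-inj) (a≢d ∘ f-inj) (b≢c ∘ f-inj) (b≢d ∘ f-inj) (c≢d ∘ f-inj)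

-- The hub 0 is joined to everything, and ⌊ suc x /2⌋ pairs up 1 with 2, 3 with 4, and so on.
Windmill : Rel ℕ _
Windmill x y = x ≡ 0 ⊎ y ≡ 0 ⊎ ⌊ suc x /2⌋ ≡ ⌊ suc y /2⌋

windmill? : Decidable Windmill
windmill? x y = x ≟ℕ 0 ⊎-dec y ≟ℕ 0 ⊎-dec ⌊ suc x /2⌋ ≟ℕ ⌊ suc y /2⌋

windmill-sym : Symmetric Windmill
windmill-sym (inj₁ x≡0)        = inj₂ (inj₁ x≡0)
windmill-sym (inj₂ (inj₁ y≡0)) = inj₁ y≡0
windmill-sym (inj₂ (inj₂ eq))  = inj₂ (inj₂ (sym eq))

windmill-blade : ∀ {x y} → Windmill x y → x ≢ 0 → y ≢ 0 → ⌊ suc x /2⌋ ≡ ⌊ suc y /2⌋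
windmill-blade (inj₁ x≡0)        x≢0 _   = ⊥-elim (x≢0 x≡0)
windmill-blade (inj₂ (inj₁ y≡0)) _   y≢0 = ⊥-elim (y≢0 y≡0)
windmill-blade (inj₂ (inj₂ eq))  _   _   = eq

no-three-on-a-blade : ∀ {x y z} → x ≢ y → x ≢ z → y ≢ z →
                      ⌊ suc x /2⌋ ≡ ⌊ suc y /2⌋ → ⌊ suc x /2⌋ ≡ ⌊ suc z /2⌋ → ⊥
no-three-on-a-blade x≢y x≢z y≢z xy xz =
  y≢z (suc-injective (⌊/2⌋-fibre-≤2 xy xz (x≢y ∘ suc-injective) (x≢z ∘ suc-injective)))

-- At most one corner of a four-cycle is the hub; the other three then share a blade.
windmill-C4Free : C4Free Windmill
windmill-C4Free {a} {b} {c} {d} a≢b a≢c a≢d b≢c b≢d c≢d ac ad bc bd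
  with a ≟ℕ 0 | c ≟ℕ 0 | d ≟ℕ 0
... | yes refl | _ | _ = no-three-on-a-blade b≢c b≢d c≢d
  (windmill-blade bc (a≢b ∘ sym) (a≢c ∘ sym)) (windmill-blade bd (a≢b ∘ sym) (a≢d ∘ sym))
... | no a≢0 | yes refl | _ = no-three-on-a-blade (a≢d ∘ sym) (b≢d ∘ sym) a≢b
  (windmill-blade (windmill-sym ad) (c≢d ∘ sym) a≢0) (windmill-blade (windmill-sym bd) (c≢d ∘ sym) b≢c)
... | no a≢0 | no c≢0 | yes refl = no-three-on-a-blade (a≢c ∘ sym) (b≢c ∘ sym) a≢b
  (windmill-blade (windmill-sym ac) c≢d a≢0) (windmill-blade (windmill-sym bc) c≢d b≢d)
... | no a≢0 | no c≢0 | no d≢0 = no-three-on-a-blade a≢c a≢d c≢d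
  (windmill-blade ac a≢0 c≢0) (windmill-blade ad a≢0 d≢0)

module _ {n : ℕ} where

  ends : LKV n → Fin n × Fin n
  ends = proj₁

  _∈ₑ_ : Fin n → Fin n × Fin n → Set
  z ∈ₑ (a , b) = z ≡ a ⊎ z ≡ b

  record Disjoint (u v : LKV n) : Set where
    constructor disjoint
    field apart : ∀ {z} → z ∈ₑ ends u → ¬ z ∈ₑ ends v
  open Disjoint

  ends-injective : ∀ {u v : LKV n} → ends u ≡ ends v → u ≡ v
  ends-injective {_ , p} {_ , q} refl = cong (_ ,_) (≤-irrelevant p q)

  shared⇒adjacent : ∀ {u w : LKV n} {z} → ends u ≢ ends w →
                    z ∈ₑ ends u → z ∈ₑ ends w → LKAdj n u w
  shared⇒adjacent u≢w (inj₁ refl) (inj₁ refl) = u≢w , inj₁ refl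
  shared⇒adjacent u≢w (inj₁ refl) (inj₂ refl) = u≢w , inj₂ (inj₁ refl)
  shared⇒adjacent u≢w (inj₂ refl) (inj₁ refl) = u≢w , inj₂ (inj₂ (inj₁ refl))
  shared⇒adjacent u≢w (inj₂ refl) (inj₂ refl) = u≢w , inj₂ (inj₂ (inj₂ refl))

  disjoint⇒¬adjacent : ∀ {u v : LKV n} → Disjoint u v → ¬ LKAdj n u v
  disjoint⇒¬adjacent uv (_ , inj₁ a≡c)               = apart uv (inj₁ refl) (inj₁ a≡c)
  disjoint⇒¬adjacent uv (_ , inj₂ (inj₁ a≡d))        = apart uv (inj₁ refl) (inj₂ a≡d)
  disjoint⇒¬adjacent uv (_ , inj₂ (inj₂ (inj₁ b≡c))) = apart uv (inj₂ refl) (inj₁ b≡c)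
  disjoint⇒¬adjacent uv (_ , inj₂ (inj₂ (inj₂ b≡d))) = apart uv (inj₂ refl) (inj₂ b≡d)

  disjoint⇒≢ : ∀ {u v : LKV n} → Disjoint u v → u ≢ v
  disjoint⇒≢ uv refl = apart uv (inj₁ refl) (inj₁ refl)

  _∈ₑ?_ : ∀ z e → Dec (z ∈ₑ e)
  z ∈ₑ? (a , b) = z ≟ᶠ a ⊎-dec z ≟ᶠ b

  classify : ∀ (u v : LKV n) → u ≡ v ⊎ LKAdj n u v ⊎ Disjoint u v
  classify u v with ≡-dec _≟ᶠ_ _≟ᶠ_ (ends u) (ends v)
  ... | yes eq = inj₁ (ends-injective eq)
  ... | no u≢v with proj₁ (ends u) ∈ₑ? ends v | proj₂ (ends u) ∈ₑ? ends v
  ...   | yes a∈v | _       = inj₂ (inj₁ (shared⇒adjacent {u} {v} u≢v (inj₁ refl) a∈v))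
  ...   | no _    | yes b∈v = inj₂ (inj₁ (shared⇒adjacent {u} {v} u≢v (inj₂ refl) b∈v))
  ...   | no a∉v  | no b∉v  = inj₂ (inj₂ (disjoint λ { (inj₁ refl) → a∉v ; (inj₂ refl) → b∉v }))

  edgeBetween : ∀ {x y} → x ≢ y → Σ[ w ∈ LKV n ] (ends w ≡ (x , y) ⊎ ends w ≡ (y , x))
  edgeBetween {x} {y} x≢y with <-cmp x y
  ... | tri< x<y _ _ = ((x , y) , x<y) , inj₁ refl
  ... | tri≈ _ x≡y _ = ⊥-elim (x≢y x≡y)
  ... | tri> _ _ y<x = ((y , x) , y<x) , inj₂ refl

  walk-length≥1 : ∀ {u v} → u ≢ v → (q : Walk (LKAdj n) u v) → 1 ≤ len (LKAdj n) q
  walk-length≥1 u≢v nil        = ⊥-elim (u≢v refl)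
  walk-length≥1 u≢v (cons _ _) = s≤s z≤n

  walk-length≥2 : ∀ {u v} → u ≢ v → ¬ LKAdj n u v → (q : Walk (LKAdj n) u v) → 2 ≤ len (LKAdj n) q
  walk-length≥2 u≢v ¬uv nil                 = ⊥-elim (u≢v refl)
  walk-length≥2 u≢v ¬uv (cons uv nil)       = ⊥-elim (¬uv uv)
  walk-length≥2 u≢v ¬uv (cons _ (cons _ _)) = s≤s (s≤s z≤n)

  module _ (X : List (LKV n)) where

    visible-refl : ∀ u → Visible (LKAdj n) X u u
    visible-refl u = nil , (λ _ → z≤n) , λ _ ()

    visible-adjacent : ∀ {u v} → LKAdj n u v → Visible (LKAdj n) X u v
    visible-adjacent uv = cons uv nil , walk-length≥1 (λ { refl → proj₁ uv refl }) , λ _ ()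

    visible-via-cross-edge : ∀ {u v x y} {w : LKV n} → Disjoint u v →
                             x ∈ₑ ends u → y ∈ₑ ends v → x ∈ₑ ends w → y ∈ₑ ends w → w ∉ X →
                             Visible (LKAdj n) X u v
    visible-via-cross-edge {u} {v} {w = w} uv x∈u y∈v x∈w y∈w w∉X =
      cons (shared⇒adjacent {u} {w} u≢w x∈u x∈w) (cons (shared⇒adjacent {w} {v} w≢v y∈w y∈v) nil) ,
      walk-length≥2 (disjoint⇒≢ uv) (disjoint⇒¬adjacent uv) ,
      λ { _ (here refl) → w∉X }
      where
      u≢w : ends u ≢ ends w
      u≢w eq = apart uv (subst (_ ∈ₑ_) (sym eq) y∈w) y∈v
      w≢v : ends w ≢ ends v
      w≢v eq = apart uv x∈u (subst (_ ∈ₑ_) eq x∈w)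

    module _ {F : Rel (Fin n) ℓ} (X⊆F : ∀ {w} → w ∈ X → F (proj₁ (ends w)) (proj₂ (ends w)))
             where

      visible-across : Symmetric F → ∀ {u v x y} → Disjoint u v →
                       x ∈ₑ ends u → y ∈ₑ ends v → ¬ F x y → Visible (LKAdj n) X u v
      visible-across F-sym {x = x} {y} uv x∈u y∈v ¬xy
        with edgeBetween {x} {y} (λ { refl → apart uv x∈u y∈v })
      ... | w , inj₁ refl = visible-via-cross-edge {w = w} uv x∈u y∈v (inj₁ refl) (inj₂ refl)
                              (¬xy ∘ X⊆F)
      ... | w , inj₂ refl = visible-via-cross-edge {w = w} uv x∈u y∈v (inj₂ refl) (inj₁ refl)
                              (¬xy ∘ F-sym ∘ X⊆F)

      -- If all four cross edges were in X they would form a four-cycle of F.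
      visible-if-disjoint : Decidable F → Symmetric F → C4Free F →
                            ∀ {u v} → Disjoint u v → Visible (LKAdj n) X u v
      visible-if-disjoint F? F-sym c4 {u@((a , b) , a<b)} {v@((c , d) , c<d)} uv
        with F? a c | F? a d | F? b c | F? b d
      ... | no ¬ac | _      | _      | _      = visible-across F-sym uv (inj₁ refl) (inj₁ refl) ¬ac
      ... | yes _  | no ¬ad | _      | _      = visible-across F-sym uv (inj₁ refl) (inj₂ refl) ¬ad
      ... | yes _  | yes _  | no ¬bc | _      = visible-across F-sym uv (inj₂ refl) (inj₁ refl) ¬bc
      ... | yes _  | yes _  | yes _  | no ¬bd = visible-across F-sym uv (inj₂ refl) (inj₂ refl) ¬bd
      ... | yes ac | yes ad | yes bc | yes bd = ⊥-elim
        (c4 (<⇒≢ a<b) (apart uv (inj₁ refl) ∘ inj₁) (apart uv (inj₁ refl) ∘ inj₂)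
            (apart uv (inj₂ refl) ∘ inj₁) (apart uv (inj₂ refl) ∘ inj₂) (<⇒≢ c<d) ac ad bc bd)
        where
        <⇒≢ : ∀ {x y : Fin n} → toℕ x < toℕ y → x ≢ y
        <⇒≢ x<y refl = <-irrefl refl x<y

      C4Free⇒totalMutualVisibility : Decidable F → Symmetric F → C4Free F →
                                     IsTotalMutualVisibility (LKAdj n) X
      C4Free⇒totalMutualVisibility F? F-sym c4 u v with classify u v
      ... | inj₁ refl       = visible-refl u
      ... | inj₂ (inj₁ u~v) = visible-adjacent u~v
      ... | inj₂ (inj₂ uv)  = visible-if-disjoint F? F-sym c4 uv

spoke : ∀ {N} → Fin N → LKV (suc N)
spoke j = (fzero , fsuc j) , s≤s z≤n

shift : ∀ {N} → LKV N → LKV (suc N)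
shift ((a , b) , a<b) = (fsuc a , fsuc b) , s≤s a<b

spoke-injective : ∀ {N} → Injective _≡_ _≡_ (spoke {N})
spoke-injective refl = refl

shift-injective : ∀ {N} → Injective _≡_ _≡_ (shift {N})
shift-injective {x = _ , p} {y = _ , q} refl = cong (_ ,_) (≤-irrelevant p q)

spoke≢shift : ∀ {N} (j : Fin N) w → spoke j ≢ shift w
spoke≢shift _ _ ()

matching : ∀ N → List (LKV N)
matching zero          = []
matching (suc zero)    = []
matching (suc (suc N)) = spoke fzero ∷ map (shift ∘ shift) (matching N)

matching-blade : ∀ N {w} → w ∈ matching N → ⌊ toℕ (proj₁ (ends w)) /2⌋ ≡ ⌊ toℕ (proj₂ (ends w)) /2⌋
matching-blade (suc (suc N)) (here refl) = refl
matching-blade (suc (suc N)) (there w∈) with ∈-map⁻ (shift ∘ shift) w∈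
... | _ , w′∈ , refl = cong suc (matching-blade N w′∈)

matching-unique : ∀ N → Unique (matching N)
matching-unique zero          = []
matching-unique (suc zero)    = []
matching-unique (suc (suc N)) =
  All.tabulate fresh ∷
  Unique.map⁺ (shift-injective ∘ shift-injective) (matching-unique N)
  where
  fresh : ∀ {y} → y ∈ map (shift ∘ shift) (matching N) → spoke fzero ≢ y
  fresh y∈ with ∈-map⁻ (shift ∘ shift) y∈
  ... | w , _ , refl = spoke≢shift fzero (shift w)

length-matching : ∀ N → length (matching N) ≡ ⌊ N /2⌋
length-matching zero          = refl
length-matching (suc zero)    = refl
length-matching (suc (suc N)) =
  cong suc (trans (length-map (shift ∘ shift) (matching N)) (length-matching N))

windmillEdges : ∀ N → List (LKV (suc N))
windmillEdges N = map spoke (allFin N) ++ map shift (matching N)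

windmillEdges⊆windmill : ∀ N {w} → w ∈ windmillEdges N →
                         (Windmill on toℕ) (proj₁ (ends w)) (proj₂ (ends w))
windmillEdges⊆windmill N w∈ with ∈-++⁻ (map spoke (allFin N)) w∈
... | inj₁ w∈spokes with ∈-map⁻ spoke w∈spokes
...   | _ , _ , refl = inj₁ refl
windmillEdges⊆windmill N w∈ | inj₂ w∈shifted with ∈-map⁻ shift w∈shifted
...   | w′ , w′∈ , refl = inj₂ (inj₂ (cong suc (matching-blade N w′∈)))

windmillEdges-unique : ∀ N → Unique (windmillEdges N)
windmillEdges-unique N =
  Unique.++⁺ (Unique.map⁺ spoke-injective (Unique.allFin⁺ N))
             (Unique.map⁺ shift-injective (matching-unique N))
             spoke≢shifted
  where
  spoke≢shifted : ∀ {w} → ¬ (w ∈ map spoke (allFin N) × w ∈ map shift (matching N))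
  spoke≢shifted (w∈spokes , w∈shifted) with ∈-map⁻ spoke w∈spokes | ∈-map⁻ shift w∈shifted
  ... | j , _ , refl | w , _ , eq = spoke≢shift j w eq

length-windmillEdges : ∀ N → length (windmillEdges N) ≡ N + ⌊ N /2⌋
length-windmillEdges N = begin
  length (map spoke (allFin N) ++ map shift (matching N))
    ≡⟨ length-++ (map spoke (allFin N)) ⟩
  length (map spoke (allFin N)) + length (map shift (matching N))
    ≡⟨ cong₂ _+_ (trans (length-map spoke (allFin N)) (length-tabulate (λ j → j)))
                 (trans (length-map shift (matching N)) (length-matching N)) ⟩
  N + ⌊ N /2⌋ ∎
  where open ≡-Reasoning

windmill-μt : ∀ N → μt≥ (LKAdj (suc N)) (N + N / 2)
windmill-μt N =
  windmillEdges N ,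
  windmillEdges-unique N ,
  ≤-reflexive (trans (cong (N +_) (n/2≡⌊n/2⌋ N)) (sym (length-windmillEdges N))) ,
  C4Free⇒totalMutualVisibility (windmillEdges N) (windmillEdges⊆windmill N)
    (On.decidable toℕ Windmill windmill?) (On.symmetric toℕ Windmill windmill-sym)
    (C4Free-on toℕ toℕ-injective windmill-C4Free)

-- The windmill bound holds for every n ≥ 1.
proposition3p5 : (n : ℕ) → 3 ≤ n → μt≥ (LKAdj n) ((n ∸ 1) + ((n ∸ 1) / 2))
proposition3p5 (suc N) _ = windmill-μt N
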